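{- Let $\pi\in\mathbf S_n$ and $\Gamma(\pi)=(d,l)$ with $d=d_1\cdots d_n$, $l=(l_1,\dots,l_n)$. Then $\pi\in\mathbf S_n(\underline{132},\underline{123})$ if and only if (i) $d$ has no horizontal steps of the second color $\widetilde H$, and (ii) for every index $i$, $l_i>0$ implies $d_i=D$.
   Context: A bicolored Motzkin path of length $n$ is a word over $\{U,D,H,\widetilde H\}$ whose steps $U=(1,1)$, $D=(1,-1)$, $H=\widetilde H=(1,0)$ go from $(0,0)$ to $(n,0)$ staying weakly above the $x$-axis, with no $\widetilde H$ step on the $x$-axis. The map $\Gamma$: for $\pi\in\mathbf S_n$ (one-line notation), write $\pi=w_1\cdots w_k$ as the concatenation of its ascending runs (maximal increasing factors). The first and last elements of a run of length $\ge2$ are a head and a tail; the element of a run of length $1$ is a head-tail; other elements are boarders. For each value $i\in\{1,\dots,n\}$ put $d_i=H$ if $i$ is a head-tail, $U$ if $i$ is a head, $D$ if $i$ is a tail, $\widetilde H$ if $i$ is a boarder. Let $l_i=|\{j: s_j<i<t_j,\ t_j \text{ precedes } i \text{ in } \pi\}|$, where $s_j,t_j$ are the first and last elements of $w_j$. Then $\Gamma(\pi)=(d_1\cdots d_n,(l_1,\dots,l_n))$. $\mathbf S_n(\underline{132},\underline{123})$ is the set of $\pi\in\mathbf S_n$ with no three consecutive entries order-isomorphic to $132$ or $123$. -}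

module Defs where

open import Data.Nat using (ℕ; zero; suc; _+_; _<_; _<ᵇ_; _≡ᵇ_)
open import Data.Bool using (Bool; true; false; _∧_; if_then_else_)
open import Data.List using (List; []; _∷_; length; applyUpTo; filter; head; last)
open import Data.List.Relation.Binary.Permutation.Propositional using (_↭_)
open import Data.Maybe using (Maybe; just; nothing)
open import Data.Vec using (Vec; tabulate)
open import Data.Fin using (Fin; toℕ)
open import Data.Product using (_×_; _,_)
open import Data.Unit using (⊤)
open import Relation.Nullary using (¬_)

IsPerm : ℕ → List ℕ → Set
IsPerm n π = π ↭ applyUpTo suc n

-- Consecutive-pattern avoidance of 132 and 123 (underlined patterns):
-- no three consecutive entries a b c with a < c < b (132) or a < b < c (123).
Avoids132-123 : List ℕ → Set
Avoids132-123 (a ∷ b ∷ c ∷ xs) =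
  ¬ (a < c × c < b) × ¬ (a < b × b < c) × Avoids132-123 (b ∷ c ∷ xs)
Avoids132-123 _ = ⊤

-- Decomposition of a word into its ascending runs (maximal increasing factors),
-- in order: π = w₁ ⋯ w_k.
consRun : ℕ → List (List ℕ) → List (List ℕ)
consRun x []       = (x ∷ []) ∷ []
consRun x (r ∷ rs) = (x ∷ r) ∷ rs

runs : List ℕ → List (List ℕ)
runs []           = []
runs (x ∷ [])     = (x ∷ []) ∷ []
runs (x ∷ y ∷ xs) = if x <ᵇ y then consRun x (runs (y ∷ xs))
                              else (x ∷ []) ∷ runs (y ∷ xs)

-- Steps of a bicolored Motzkin path: U, D, H and H̃ (second-colour horizontal).
data Step : Set where
  U D H H̃ : Step

elemᵇ : ℕ → List ℕ → Bool
elemᵇ i []       = false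
elemᵇ i (x ∷ xs) = if i ≡ᵇ x then true else elemᵇ i xs

-- first element s_j and last element t_j of a run (runs are nonempty; 0 is a dummy)
firstOf : List ℕ → ℕ
firstOf []      = 0
firstOf (x ∷ _) = x

lastOf : List ℕ → ℕ
lastOf []           = 0
lastOf (x ∷ [])     = x
lastOf (_ ∷ y ∷ xs) = lastOf (y ∷ xs)

classify : ℕ → List ℕ → Step
classify i (x ∷ []) = H
classify i w = if i ≡ᵇ firstOf w then U
               else if i ≡ᵇ lastOf w then D
               else H̃

-- d_i : the step attached to the value i (H is a dummy for values not in π)
stepIn : ℕ → List (List ℕ) → Step
stepIn i []       = H
stepIn i (w ∷ ws) = if elemᵇ i w then classify i w else stepIn i ws

stepOf : List ℕ → ℕ → Step
stepOf π i = stepIn i (runs π)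

-- position (0-based) of a value in π
posOf : ℕ → List ℕ → ℕ
posOf i []       = 0
posOf i (x ∷ xs) = if i ≡ᵇ x then 0 else suc (posOf i xs)

countᵇ : {A : Set} → (A → Bool) → List A → ℕ
countᵇ p []       = 0
countᵇ p (x ∷ xs) = if p x then suc (countᵇ p xs) else countᵇ p xs

levelOf : List ℕ → ℕ → ℕ
levelOf π i = countᵇ (λ w → (firstOf w <ᵇ i) ∧ (i <ᵇ lastOf w)
                            ∧ (posOf (lastOf w) π <ᵇ posOf i π)) (runs π)

-- Γ(π) = (d₁⋯dₙ, (l₁,…,lₙ)); entry k : Fin n corresponds to the value i = k+1.
Γ : (n : ℕ) → List ℕ → Vec Step n × Vec ℕ n
Γ n π = tabulate (λ k → stepOf π (suc (toℕ k))) , tabulate (λ k → levelOf π (suc (toℕ k)))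

-- The equivalence is proved for the entries of any word without repetition
-- (`avoids⇔conditions`); translating to the Fin n-indexed Γ uses only that the
-- entries of a permutation of [n] are 1, …, n.
--
-- (⇒) An avoiding word has no ascending run of length ≥ 3 (it would contain a 123),
-- so its runs are `pairRuns`, which have no boarders.  If a run (s, t) covers v
-- (s < v < t, t before v), the entry after t drops below s (`ascent-then-below`), and
-- from there on every larger entry is a tail (`larger-are-tails`).
-- (⇐) At a consecutive 123 the middle entry is a boarder.  At a consecutive 132
-- (a, b, c) either a is a boarder, or (a, b) is a whole run and then c heads the next
-- run although (a, b) covers c.
module Submission where

open import Defs
open import Data.Nat using (ℕ; suc; _+_; _<_; _≤_; _<ᵇ_; _≡ᵇ_; _<?_; _≟_; z≤n; s≤s)
open import Data.Nat.Properties
  using (<ᵇ⇒<; <⇒<ᵇ; ≡ᵇ⇒≡; ≡⇒≡ᵇ; <-irrefl; <-asym; <-trans; <-≤-trans; <-cmp; ≮⇒≥; ≤∧≢⇒<;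
         <⇒≢; ≤-refl; ≤-trans; <⇒≤; +-identityʳ; m<m+n; suc-injective)
open import Data.Bool using (Bool; true; false; _∧_; if_then_else_)
open import Data.Bool.Properties using (T-≡)
open import Data.Empty using (⊥; ⊥-elim)
open import Data.Fin using (Fin; toℕ; fromℕ<)
open import Data.Fin.Properties using (toℕ<n; toℕ-fromℕ<)
open import Data.List using (List; []; _∷_; _++_; [_]; concat; length)
open import Data.List.Properties using (++-assoc; ∷-injective)
open import Data.List.Membership.Propositional using (_∈_; _∉_)
open import Data.List.Membership.Propositional.Properties
  using (∈-++⁺ˡ; ∈-++⁺ʳ; ∈-++⁻; ∈-applyUpTo⁺; ∈-applyUpTo⁻)
open import Data.List.Membership.DecPropositional _≟_ using (_∈?_)
open import Data.List.Relation.Unary.Any as Any using (here; there)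
open import Data.List.Relation.Unary.All using (All; []; _∷_)
open import Data.List.Relation.Unary.All.Properties using (All¬⇒¬Any)
open import Data.List.Relation.Unary.AllPairs using (_∷_)
open import Data.List.Relation.Unary.Unique.Propositional using (Unique)
open import Data.List.Relation.Unary.Unique.Propositional.Properties using (applyUpTo⁺₁)
open import Data.List.Relation.Binary.Permutation.Propositional using (↭-sym; ↭⇒↭ₛ)
open import Data.List.Relation.Binary.Permutation.Propositional.Properties using (∈-resp-↭)
open import Relation.Binary.PropositionalEquality
  using (_≡_; _≢_; refl; sym; trans; cong; subst; setoid; module ≡-Reasoning)
open import Data.List.Relation.Binary.Permutation.Setoid.Properties (setoid ℕ)
  using (Unique-resp-↭)
open import Data.Vec using (lookup)
open import Data.Vec.Properties using (lookup∘tabulate)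
open import Data.Product using (Σ; _×_; _,_; proj₁; proj₂)
open import Data.Product.Function.NonDependent.Propositional using (_×-⇔_)
open import Data.Sum using (_⊎_; inj₁; inj₂)
open import Function using (_∘_)
open import Function.Bundles using (_⇔_; mk⇔; Equivalence)
open import Function.Properties.Equivalence using () renaming (sym to ⇔-sym; trans to ⇔-trans)
open import Relation.Nullary using (¬_; yes; no)
open import Relation.Binary using (tri<; tri≈; tri>)

<ᵇ-true : ∀ {x y} → x < y → (x <ᵇ y) ≡ true
<ᵇ-true x<y = Equivalence.to T-≡ (<⇒<ᵇ x<y)

<ᵇ-sound : ∀ {x y} → (x <ᵇ y) ≡ true → x < y
<ᵇ-sound {x} {y} e = <ᵇ⇒< x y (Equivalence.from T-≡ e)

<ᵇ-false : ∀ {x y} → ¬ x < y → (x <ᵇ y) ≡ false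
<ᵇ-false {x} {y} x≮y with x <ᵇ y in e
... | false = refl
... | true  = ⊥-elim (x≮y (<ᵇ-sound e))

≡ᵇ-refl : ∀ x → (x ≡ᵇ x) ≡ true
≡ᵇ-refl x = Equivalence.to T-≡ (≡⇒≡ᵇ x x refl)

≡ᵇ-false : ∀ {x y} → x ≢ y → (x ≡ᵇ y) ≡ false
≡ᵇ-false {x} {y} x≢y with x ≡ᵇ y in e
... | false = refl
... | true  = ⊥-elim (x≢y (≡ᵇ⇒≡ x y (Equivalence.from T-≡ e)))

∧-true : ∀ {a b} → (a ∧ b) ≡ true → a ≡ true × b ≡ true
∧-true {true} e = refl , e

unique-suffix : ∀ X {Y : List ℕ} → Unique (X ++ Y) → Unique Y
unique-suffix []      u       = u
unique-suffix (_ ∷ X) (_ ∷ u) = unique-suffix X u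

∉-prefix : ∀ X {Y : List ℕ} {v} → Unique (X ++ Y) → v ∈ Y → v ∉ X
∉-prefix (x ∷ X) (x≢ ∷ _) v∈Y (here refl)  = All¬⇒¬Any x≢ (∈-++⁺ʳ X v∈Y)
∉-prefix (x ∷ X) (_ ∷ u)  v∈Y (there v∈X) = ∉-prefix X u v∈Y v∈X

module _ {n : ℕ} {π : List ℕ} (perm : IsPerm n π) where

  perm-unique : Unique π
  perm-unique =
    Unique-resp-↭ (↭⇒↭ₛ (↭-sym perm)) (applyUpTo⁺₁ suc n (λ i<j _ → <⇒≢ i<j ∘ suc-injective))

  values⇔entries : (P : ℕ → Set) → ((k : Fin n) → P (suc (toℕ k))) ⇔ (∀ v → v ∈ π → P v)
  values⇔entries P = mk⇔ toEntries (λ h k → h (suc (toℕ k)) (value-∈ k))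
    where
    value-∈ : (k : Fin n) → suc (toℕ k) ∈ π
    value-∈ k = ∈-resp-↭ (↭-sym perm) (∈-applyUpTo⁺ suc (toℕ<n k))

    toEntries : ((k : Fin n) → P (suc (toℕ k))) → ∀ v → v ∈ π → P v
    toEntries h v v∈π with ∈-applyUpTo⁻ suc (∈-resp-↭ perm v∈π)
    ... | i , i<n , refl = subst P (cong suc (toℕ-fromℕ< i<n)) (h (fromℕ< i<n))

elemᵇ-∈ : ∀ {v} xs → v ∈ xs → elemᵇ v xs ≡ true
elemᵇ-∈ {v} (_ ∷ _)  (here refl) rewrite ≡ᵇ-refl v = refl
elemᵇ-∈ {v} (x ∷ xs) (there v∈) with v ≡ᵇ x
... | true  = refl
... | false = elemᵇ-∈ xs v∈

elemᵇ-∉ : ∀ {v} xs → v ∉ xs → elemᵇ v xs ≡ false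
elemᵇ-∉ []       _   = refl
elemᵇ-∉ (x ∷ xs) v∉ rewrite ≡ᵇ-false (v∉ ∘ here) = elemᵇ-∉ xs (v∉ ∘ there)

stepIn-here : ∀ {v} W rs → v ∈ W → stepIn v (W ∷ rs) ≡ classify v W
stepIn-here W _ v∈W rewrite elemᵇ-∈ W v∈W = refl

stepIn-there : ∀ {v} W rs → v ∉ W → stepIn v (W ∷ rs) ≡ stepIn v rs
stepIn-there W _ v∉W rewrite elemᵇ-∉ W v∉W = refl

stepIn-++ : ∀ {v} A Z → v ∉ concat A → stepIn v (A ++ Z) ≡ stepIn v Z
stepIn-++ []      _ _  = refl
stepIn-++ (W ∷ A) Z v∉ =
  trans (stepIn-there W (A ++ Z) (v∉ ∘ ∈-++⁺ˡ)) (stepIn-++ A Z (v∉ ∘ ∈-++⁺ʳ W))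

classify-boarder : ∀ {v W} → v ∈ W → v ≢ firstOf W → v ≢ lastOf W → classify v W ≡ H̃
classify-boarder {W = _ ∷ []}    (here refl) v≢first _ = ⊥-elim (v≢first refl)
classify-boarder {W = _ ∷ _ ∷ _} _ v≢first v≢last
  rewrite ≡ᵇ-false v≢first | ≡ᵇ-false v≢last = refl

classify-first : ∀ c r → classify c (c ∷ r) ≢ D
classify-first c []      ()
classify-first c (_ ∷ _) rewrite ≡ᵇ-refl c = λ ()

classify-second : ∀ {s t} → t ≢ s → classify t (s ∷ t ∷ []) ≡ D
classify-second {t = t} t≢s rewrite ≡ᵇ-false t≢s | ≡ᵇ-refl t = refl

firstOf-++ : ∀ {v a} q M → v ∉ q → v ≢ a → v ≢ firstOf (q ++ a ∷ M)
firstOf-++ []      _ _   v≢a = v≢a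
firstOf-++ (_ ∷ _) _ v∉q _   = v∉q ∘ here

lastOf-++ : ∀ q y ys → lastOf (q ++ y ∷ ys) ≡ lastOf (y ∷ ys)
lastOf-++ []          _ _  = refl
lastOf-++ (_ ∷ [])    _ _  = refl
lastOf-++ (_ ∷ z ∷ q) y ys = lastOf-++ (z ∷ q) y ys

posOf-head : ∀ v xs → posOf v (v ∷ xs) ≡ 0
posOf-head v _ rewrite ≡ᵇ-refl v = refl

posOf-++ : ∀ {v} X Y → v ∉ X → posOf v (X ++ Y) ≡ length X + posOf v Y
posOf-++     []      _ _  = refl
posOf-++ {v} (x ∷ X) Y v∉ rewrite ≡ᵇ-false (v∉ ∘ here) = cong suc (posOf-++ X Y (v∉ ∘ there))

posOf-∈ : ∀ {v} X Y → v ∈ X → posOf v (X ++ Y) < length X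
posOf-∈ {v} (_ ∷ X) Y (here refl) rewrite ≡ᵇ-refl v = s≤s z≤n
posOf-∈ {v} (x ∷ X) Y (there v∈) with v ≡ᵇ x
... | true  = s≤s z≤n
... | false = s≤s (posOf-∈ X Y v∈)

posOf-at : ∀ P {t} R → t ∉ P → posOf t (P ++ t ∷ R) ≡ length P
posOf-at P {t} R t∉P =
  trans (posOf-++ P _ t∉P) (trans (cong (length P +_) (posOf-head t R)) (+-identityʳ _))

entry-after : ∀ P R {t v} → t ∉ P → v ∈ P ++ t ∷ R →
  posOf t (P ++ t ∷ R) < posOf v (P ++ t ∷ R) → v ∈ R
entry-after P R {t} {v} t∉P v∈ t<v with ∈-++⁻ P v∈
... | inj₁ v∈P =
  ⊥-elim (<-asym t<v (subst (posOf v (P ++ t ∷ R) <_) (sym (posOf-at P R t∉P)) (posOf-∈ P _ v∈P)))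
... | inj₂ (here refl) = ⊥-elim (<-irrefl refl t<v)
... | inj₂ (there v∈R) = v∈R

posOf-adjacent : ∀ P R {x y} → x ∉ P → y ∉ P → y ≢ x →
  posOf x (P ++ x ∷ y ∷ R) < posOf y (P ++ x ∷ y ∷ R)
posOf-adjacent P R {x} {y} x∉P y∉P y≢x
  rewrite posOf-at P (y ∷ R) x∉P | posOf-++ P (x ∷ y ∷ R) y∉P | ≡ᵇ-false y≢x | posOf-head y R =
  m<m+n (length P) (s≤s z≤n)

countᵇ-witness : ∀ {A : Set} (p : A → Bool) xs → 0 < countᵇ p xs →
  Σ (List A) λ pre → Σ A λ x → Σ (List A) λ post → xs ≡ pre ++ x ∷ post × p x ≡ true
countᵇ-witness p (x ∷ xs) pos with p x in px
... | true  = [] , x , xs , refl , px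
... | false with countᵇ-witness p xs pos
...   | pre , y , post , refl , py = x ∷ pre , y , post , refl , py

countᵇ-positive : ∀ {A : Set} (p : A → Bool) pre {x : A} post → p x ≡ true → 0 < countᵇ p (pre ++ x ∷ post)
countᵇ-positive p []        _ px rewrite px = s≤s z≤n
countᵇ-positive p (y ∷ pre) post px with p y
... | true  = s≤s z≤n
... | false = countᵇ-positive p pre post px

avoids-tail : ∀ x xs → Avoids132-123 (x ∷ xs) → Avoids132-123 xs
avoids-tail _ []              _            = _
avoids-tail _ (_ ∷ [])        _            = _
avoids-tail _ (_ ∷ _ ∷ [])    _            = _
avoids-tail _ (_ ∷ _ ∷ _ ∷ _) (_ , _ , av) = av

avoids-suffix : ∀ X {Y} → Avoids132-123 (X ++ Y) → Avoids132-123 Y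
avoids-suffix []      av = av
avoids-suffix (x ∷ X) av = avoids-suffix X (avoids-tail x _ av)

-- In an avoiding word without repetition, an ascent a < b is followed by an entry below a:
-- anything between a and b would be a 132, anything above b a 123.
ascent-then-below : ∀ {a b c xs} → Unique (a ∷ b ∷ c ∷ xs) → Avoids132-123 (a ∷ b ∷ c ∷ xs) →
  a < b → c < a
ascent-then-below ((_ ∷ a≢c ∷ _) ∷ (b≢c ∷ _) ∷ _) (no132 , no123 , _) a<b with <-cmp _ _
... | tri< c<a _ _ = c<a
... | tri≈ _ c≡a _ = ⊥-elim (a≢c (sym c≡a))
... | tri> _ _ a<c with <-cmp _ _
...   | tri< c<b _ _ = ⊥-elim (no132 (a<c , c<b))
...   | tri≈ _ c≡b _ = ⊥-elim (b≢c (sym c≡b))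
...   | tri> _ _ b<c = ⊥-elim (no123 (a<b , b<c))

runs-asc : ∀ {x y} xs → x < y → runs (x ∷ y ∷ xs) ≡ consRun x (runs (y ∷ xs))
runs-asc _ x<y rewrite <ᵇ-true x<y = refl

runs-desc : ∀ {x y} xs → ¬ x < y → runs (x ∷ y ∷ xs) ≡ [ x ] ∷ runs (y ∷ xs)
runs-desc _ x≮y rewrite <ᵇ-false x≮y = refl

runs-double-ascent : ∀ {a b c} rest {r rs} → a < b → b < c → runs (c ∷ rest) ≡ (c ∷ r) ∷ rs →
  runs (a ∷ b ∷ c ∷ rest) ≡ (a ∷ b ∷ c ∷ r) ∷ rs
runs-double-ascent {a} {b} {c} rest a<b b<c runs-c =
  trans (runs-asc (c ∷ rest) a<b) (cong (consRun a) (trans (runs-asc rest b<c) (cong (consRun b) runs-c)))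

runs-peak : ∀ {a b c} rest → a < b → ¬ b < c → runs (a ∷ b ∷ c ∷ rest) ≡ (a ∷ b ∷ []) ∷ runs (c ∷ rest)
runs-peak {a} {b} {c} rest a<b b≮c = trans (runs-asc (c ∷ rest) a<b) (cong (consRun a) (runs-desc rest b≮c))

runs-prepend : ∀ p M → runs (p ∷ M) ≡ consRun p (runs M) ⊎ runs (p ∷ M) ≡ [ p ] ∷ runs M
runs-prepend p []      = inj₂ refl
runs-prepend p (m ∷ M) with p <? m
... | yes p<m = inj₁ (runs-asc M p<m)
... | no  p≮m = inj₂ (runs-desc M p≮m)

runs-first : ∀ x xs → Σ (List ℕ) λ r → Σ (List (List ℕ)) λ rs →
  runs (x ∷ xs) ≡ (x ∷ r) ∷ rs × x ≤ lastOf (x ∷ r)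
runs-first x []       = [] , [] , refl , ≤-refl
runs-first x (y ∷ ys) with x <? y | runs-first y ys
... | yes x<y | r , rs , e , y≤last =
  y ∷ r , rs , trans (runs-asc ys x<y) (cong (consRun x) e) , ≤-trans (<⇒≤ x<y) y≤last
... | no x≮y  | _ = [] , runs (y ∷ ys) , runs-desc ys x≮y , ≤-refl

runs-prefix : ∀ pre {x xs R RS} → runs (x ∷ xs) ≡ R ∷ RS →
  Σ (List (List ℕ)) λ ps → Σ (List ℕ) λ q →
    concat ps ++ q ≡ pre × runs (pre ++ x ∷ xs) ≡ ps ++ (q ++ R) ∷ RS
runs-prefix []        e = [] , [] , refl , e
runs-prefix (p ∷ pre) {x} {xs} e with runs-prefix pre e | runs-prepend p (pre ++ x ∷ xs)
... | ps     , q , refl , e′ | inj₂ new = [ p ] ∷ ps , q , refl , trans new (cong ([ p ] ∷_) e′)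
... | []     , q , refl , e′ | inj₁ ext = [] , p ∷ q , refl , trans ext (cong (consRun p) e′)
... | w ∷ ps , q , refl , e′ | inj₁ ext = (p ∷ w) ∷ ps , q , refl , trans ext (cong (consRun p) e′)

data ShortRun : List ℕ → Set where
  single : ∀ x → ShortRun [ x ]
  pair   : ∀ s t → ShortRun (s ∷ t ∷ [])

-- The runs of a word whose ascending runs have length at most two: pair every ascent.
pairRuns : List ℕ → List (List ℕ)
pairRuns []           = []
pairRuns (x ∷ [])     = [ x ] ∷ []
pairRuns (x ∷ y ∷ xs) = if x <ᵇ y then (x ∷ y ∷ []) ∷ pairRuns xs else [ x ] ∷ pairRuns (y ∷ xs)

pairRuns-asc : ∀ {x y} xs → x < y → pairRuns (x ∷ y ∷ xs) ≡ (x ∷ y ∷ []) ∷ pairRuns xs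
pairRuns-asc _ x<y rewrite <ᵇ-true x<y = refl

pairRuns-desc : ∀ {x y} xs → ¬ x < y → pairRuns (x ∷ y ∷ xs) ≡ [ x ] ∷ pairRuns (y ∷ xs)
pairRuns-desc _ x≮y rewrite <ᵇ-false x≮y = refl

pairRuns-short : ∀ L → All ShortRun (pairRuns L)
pairRuns-short []           = []
pairRuns-short (x ∷ [])     = single x ∷ []
pairRuns-short (x ∷ y ∷ xs) with x <? y | pairRuns-short xs | pairRuns-short (y ∷ xs)
... | yes x<y | shorts | _ = subst (All ShortRun) (sym (pairRuns-asc xs x<y)) (pair x y ∷ shorts)
... | no  x≮y | _ | shorts = subst (All ShortRun) (sym (pairRuns-desc xs x≮y)) (single x ∷ shorts)

-- An avoiding word has no ascending run of length three, so its runs are its pairRuns.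
runs-avoiding : ∀ L → Avoids132-123 L → runs L ≡ pairRuns L
runs-avoiding []       _ = refl
runs-avoiding (x ∷ []) _ = refl
runs-avoiding (x ∷ y ∷ []) _ with x <? y
... | yes x<y = trans (runs-asc [] x<y) (sym (pairRuns-asc [] x<y))
... | no  x≮y = trans (runs-desc [] x≮y) (sym (pairRuns-desc [] x≮y))
runs-avoiding (x ∷ y ∷ z ∷ zs) (_ , no123 , av)
  with x <? y | runs-avoiding (y ∷ z ∷ zs) av | runs-avoiding (z ∷ zs) (avoids-tail y _ av)
... | no x≮y | ih | _ = begin
  runs (x ∷ y ∷ z ∷ zs)        ≡⟨ runs-desc (z ∷ zs) x≮y ⟩
  [ x ] ∷ runs (y ∷ z ∷ zs)     ≡⟨ cong ([ x ] ∷_) ih ⟩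
  [ x ] ∷ pairRuns (y ∷ z ∷ zs) ≡⟨ pairRuns-desc (z ∷ zs) x≮y ⟨
  pairRuns (x ∷ y ∷ z ∷ zs)    ∎
  where open ≡-Reasoning
... | yes x<y | _ | ih = begin
  runs (x ∷ y ∷ z ∷ zs)            ≡⟨ runs-asc (z ∷ zs) x<y ⟩
  consRun x (runs (y ∷ z ∷ zs))    ≡⟨ cong (consRun x) (runs-desc zs (λ y<z → no123 (x<y , y<z))) ⟩
  (x ∷ y ∷ []) ∷ runs (z ∷ zs)     ≡⟨ cong ((x ∷ y ∷ []) ∷_) ih ⟩
  (x ∷ y ∷ []) ∷ pairRuns (z ∷ zs) ≡⟨ pairRuns-asc (z ∷ zs) x<y ⟨
  pairRuns (x ∷ y ∷ z ∷ zs)        ∎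
  where open ≡-Reasoning

classify-short : ∀ {v W} → ShortRun W → v ∈ W → classify v W ≢ H̃
classify-short (single _) _ ()
classify-short {v} (pair s t) (here refl) rewrite ≡ᵇ-refl v = λ ()
classify-short {v} (pair s t) (there (here refl)) with v ≡ᵇ s
... | true  = λ ()
... | false rewrite ≡ᵇ-refl v = λ ()

stepIn-noBoarder : ∀ v rs → All ShortRun rs → stepIn v rs ≢ H̃
stepIn-noBoarder v []       []             ()
stepIn-noBoarder v (W ∷ rs) (short ∷ shorts) with v ∈? W
... | yes v∈W rewrite stepIn-here W rs v∈W = classify-short short v∈W
... | no  v∉W rewrite stepIn-there W rs v∉W = stepIn-noBoarder v rs shorts

PairRunsCut : List ℕ → List (List ℕ) → List ℕ → List (List ℕ) → Set
PairRunsCut L A w B = ShortRun w × Σ (List ℕ) λ R → L ≡ concat A ++ w ++ R × pairRuns R ≡ B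

cut-cons : ∀ {W w B} → ShortRun W → ∀ M A → W ∷ pairRuns M ≡ A ++ w ∷ B →
  (∀ A → pairRuns M ≡ A ++ w ∷ B → PairRunsCut M A w B) → PairRunsCut (W ++ M) A w B
cut-cons     sW M []      refl _ = sW , M , refl , refl
cut-cons {W} sW M (_ ∷ A) eq cutM with ∷-injective eq
... | refl , eq′ with cutM A eq′
...   | sw , R , refl , eB = sw , R , sym (++-assoc W (concat A) _) , eB

pairRuns-cut : ∀ L A {w B} → pairRuns L ≡ A ++ w ∷ B → PairRunsCut L A w B
pairRuns-cut []       []          ()
pairRuns-cut []       (_ ∷ _)     ()
pairRuns-cut (x ∷ []) []          refl = single x , [] , refl , refl
pairRuns-cut (x ∷ []) (_ ∷ [])    ()
pairRuns-cut (x ∷ []) (_ ∷ _ ∷ _) ()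
pairRuns-cut (x ∷ y ∷ xs) A eq with x <? y | pairRuns-cut xs | pairRuns-cut (y ∷ xs)
... | yes x<y | cut | _ = cut-cons (pair x y) xs A (trans (sym (pairRuns-asc xs x<y)) eq) (λ A → cut A)
... | no  x≮y | _ | cut = cut-cons (single x) (y ∷ xs) A (trans (sym (pairRuns-desc xs x≮y)) eq) (λ A → cut A)

first-after-ascent : ∀ {z y v} R → Unique (z ∷ y ∷ R) → Avoids132-123 (z ∷ y ∷ R) →
  z < y → v ∈ R → firstOf R < z
first-after-ascent (_ ∷ _) u av z<y _ = ascent-then-below u av z<y

larger-are-tails : ∀ L → Unique L → Avoids132-123 L → ∀ {v} → v ∈ L → firstOf L < v →
  stepIn v (pairRuns L) ≡ D
larger-are-tails (z ∷ []) _ _ (here refl) z<v = ⊥-elim (<-irrefl refl z<v)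
larger-are-tails (z ∷ y ∷ R) u@((z≢y ∷ _) ∷ uyR) av {v} v∈ z<v
  with z <? y | larger-are-tails (y ∷ R) uyR (avoids-tail z _ av)
             | larger-are-tails R (unique-suffix (y ∷ []) uyR) (avoids-suffix (z ∷ y ∷ []) av)
... | no z≮y | ih | _ = begin
  stepIn v (pairRuns (z ∷ y ∷ R))     ≡⟨ cong (stepIn v) (pairRuns-desc R z≮y) ⟩
  stepIn v ([ z ] ∷ pairRuns (y ∷ R)) ≡⟨ stepIn-there [ z ] (pairRuns (y ∷ R)) (All¬⇒¬Any (v≢z ∷ [])) ⟩
  stepIn v (pairRuns (y ∷ R))         ≡⟨ ih (Any.tail v≢z v∈) (<-trans y<z z<v) ⟩
  D                                   ∎
  where
  open ≡-Reasoning
  v≢z = (<⇒≢ z<v) ∘ sym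
  y<z = ≤∧≢⇒< (≮⇒≥ z≮y) (z≢y ∘ sym)
... | yes z<y | _ | ih with v ≟ y
...   | yes refl = begin
  stepIn v (pairRuns (z ∷ v ∷ R))      ≡⟨ cong (stepIn v) (pairRuns-asc R z<y) ⟩
  stepIn v ((z ∷ v ∷ []) ∷ pairRuns R) ≡⟨ stepIn-here (z ∷ v ∷ []) (pairRuns R) (there (here refl)) ⟩
  classify v (z ∷ v ∷ [])              ≡⟨ classify-second (z≢y ∘ sym) ⟩
  D                                    ∎
  where open ≡-Reasoning
...   | no v≢y = begin
  stepIn v (pairRuns (z ∷ y ∷ R))      ≡⟨ cong (stepIn v) (pairRuns-asc R z<y) ⟩
  stepIn v ((z ∷ y ∷ []) ∷ pairRuns R) ≡⟨ stepIn-there (z ∷ y ∷ []) (pairRuns R) (All¬⇒¬Any (v≢z ∷ v≢y ∷ [])) ⟩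
  stepIn v (pairRuns R)                ≡⟨ ih v∈R (<-trans (first-after-ascent R u av z<y v∈R) z<v) ⟩
  D                                    ∎
  where
  open ≡-Reasoning
  v≢z = (<⇒≢ z<v) ∘ sym
  v∈R = Any.tail v≢y (Any.tail v≢z v∈)

covers : List ℕ → ℕ → List ℕ → Bool
covers π i w = (firstOf w <ᵇ i) ∧ (i <ᵇ lastOf w) ∧ (posOf (lastOf w) π <ᵇ posOf i π)

Covers : List ℕ → ℕ → List ℕ → Set
Covers π i w = firstOf w < i × i < lastOf w × posOf (lastOf w) π < posOf i π

covers-sound : ∀ π i w → covers π i w ≡ true → Covers π i w
covers-sound π i w e with ∧-true e
... | e₁ , e₂₃ with ∧-true e₂₃
...   | e₂ , e₃ = <ᵇ-sound e₁ , <ᵇ-sound e₂ , <ᵇ-sound e₃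

covers-complete : ∀ π i w → Covers π i w → covers π i w ≡ true
covers-complete π i w (p₁ , p₂ , p₃) rewrite <ᵇ-true p₁ | <ᵇ-true p₂ | <ᵇ-true p₃ = refl

-- A run (s, t) covering v forces v to lie after t; the entry following t drops
-- below s < v, and from there on every entry above it is a tail.
pair-cover-tail : ∀ A s t R {v} → Unique (concat A ++ s ∷ t ∷ R) →
  Avoids132-123 (concat A ++ s ∷ t ∷ R) → v ∈ concat A ++ s ∷ t ∷ R →
  Covers (concat A ++ s ∷ t ∷ R) v (s ∷ t ∷ []) →
  stepIn v (A ++ (s ∷ t ∷ []) ∷ pairRuns R) ≡ D
pair-cover-tail A s t R {v} u av v∈ (s<v , v<t , t-before-v) = begin
  stepIn v (A ++ (s ∷ t ∷ []) ∷ pairRuns R) ≡⟨ stepIn-++ A _ (∉-prefix X u (there (there v∈R))) ⟩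
  stepIn v ((s ∷ t ∷ []) ∷ pairRuns R)      ≡⟨ stepIn-there (s ∷ t ∷ []) (pairRuns R) v∉st ⟩
  stepIn v (pairRuns R)                     ≡⟨ tail-in R uR avR v∈R ⟩
  D                                         ∎
  where
  open ≡-Reasoning
  X = concat A
  s<t = <-trans s<v v<t
  v∉st = All¬⇒¬Any (((<⇒≢ s<v) ∘ sym) ∷ (<⇒≢ v<t) ∷ [])
  regroup : X ++ s ∷ t ∷ R ≡ (X ++ [ s ]) ++ t ∷ R
  regroup = sym (++-assoc X [ s ] (t ∷ R))
  t∉Xs : t ∉ X ++ [ s ]
  t∉Xs t∈ with ∈-++⁻ X t∈
  ... | inj₁ t∈X         = ∉-prefix X u (there (here refl)) t∈X
  ... | inj₂ (here refl) = <-irrefl refl s<t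
  v∈R : v ∈ R
  v∈R = entry-after (X ++ [ s ]) R t∉Xs (subst (v ∈_) regroup v∈)
          (subst (λ L → posOf t L < posOf v L) regroup t-before-v)
  uR : Unique (s ∷ t ∷ R)
  uR = unique-suffix X u
  avR : Avoids132-123 (s ∷ t ∷ R)
  avR = avoids-suffix X av
  tail-in : ∀ Rest → Unique (s ∷ t ∷ Rest) → Avoids132-123 (s ∷ t ∷ Rest) → v ∈ Rest →
    stepIn v (pairRuns Rest) ≡ D
  tail-in (z ∷ R′) u′@(_ ∷ _ ∷ uzR) av′ v∈zR =
    larger-are-tails (z ∷ R′) uzR (avoids-suffix (s ∷ t ∷ []) av′) v∈zR
      (<-trans (ascent-then-below u′ av′ s<t) s<v)

covered-is-tail : ∀ π {v} → Unique π → Avoids132-123 π → v ∈ π →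
  0 < countᵇ (covers π v) (pairRuns π) → stepIn v (pairRuns π) ≡ D
covered-is-tail π {v} u av v∈ pos with countᵇ-witness (covers π v) (pairRuns π) pos
... | A , w , B , eq , cov with pairRuns-cut π A eq | covers-sound π v w cov
...   | single x , _ | first<v , v<last , _ = ⊥-elim (<-asym first<v v<last)
...   | pair s t , R , refl , refl | c =
  trans (cong (stepIn v) eq) (pair-cover-tail A s t R u av v∈ c)

-- Conditions (i) and (ii) of the theorem, stated for the entries of a word.

NoBoarders : List ℕ → Set
NoBoarders π = ∀ v → v ∈ π → stepOf π v ≢ H̃

CoveredAreTails : List ℕ → Set
CoveredAreTails π = ∀ v → v ∈ π → 0 < levelOf π v → stepOf π v ≡ D

avoids⇒conditions : ∀ π → Unique π → Avoids132-123 π → NoBoarders π × CoveredAreTails π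
avoids⇒conditions π u av =
  (λ v _ → subst (λ rs → stepIn v rs ≢ H̃) (sym runs≡)
             (stepIn-noBoarder v (pairRuns π) (pairRuns-short π))) ,
  (λ v v∈ pos → trans (cong (stepIn v) runs≡)
                  (covered-is-tail π u av v∈ (subst (λ rs → 0 < countᵇ (covers π v) rs) runs≡ pos)))
  where
  runs≡ = runs-avoiding π av

123-boarder : ∀ pre {a b c} rest → Unique (pre ++ a ∷ b ∷ c ∷ rest) → a < b → b < c →
  stepOf (pre ++ a ∷ b ∷ c ∷ rest) b ≡ H̃
123-boarder pre {a} {b} {c} rest u a<b b<c with runs-first c rest
... | r , rs , runs-c , c≤last with runs-prefix pre (runs-double-ascent rest a<b b<c runs-c)
...   | ps , q , refl , runs≡ = begin
  stepIn b (runs π)        ≡⟨ cong (stepIn b) runs≡ ⟩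
  stepIn b (ps ++ W ∷ rs)  ≡⟨ stepIn-++ ps _ (b∉pre ∘ ∈-++⁺ˡ) ⟩
  stepIn b (W ∷ rs)        ≡⟨ stepIn-here W rs (∈-++⁺ʳ q (there (here refl))) ⟩
  classify b W             ≡⟨ classify-boarder (∈-++⁺ʳ q (there (here refl))) b≢first b≢last ⟩
  H̃                        ∎
  where
  open ≡-Reasoning
  π = (concat ps ++ q) ++ a ∷ b ∷ c ∷ rest
  W = q ++ a ∷ b ∷ c ∷ r
  b∉pre = ∉-prefix (concat ps ++ q) u (there (here refl))
  b≢first = firstOf-++ q _ (b∉pre ∘ ∈-++⁺ʳ (concat ps)) ((<⇒≢ a<b) ∘ sym)
  b≢last : b ≢ lastOf W
  b≢last b≡last =
    <-irrefl refl (<-≤-trans b<c (subst (c ≤_) (sym (trans b≡last (lastOf-++ q a _))) c≤last))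

-- A consecutive 132 (a, b, c) violates (i) or (ii): if the run of a starts before a,
-- then a is a boarder; otherwise (a, b) is a whole run, c heads the next run and is
-- not a tail, yet (a, b) covers c.
132-violation : ∀ pre {a b c} rest → let π = pre ++ a ∷ b ∷ c ∷ rest in
  Unique π → NoBoarders π → CoveredAreTails π → a < c → c < b → ⊥
132-violation pre {a} {b} {c} rest u noBoarders coveredTails a<c c<b
  with runs-prefix pre (runs-peak {c = c} rest (<-trans a<c c<b) (<-asym c<b))
... | ps , y ∷ q , refl , runs≡ = noBoarders a (∈-++⁺ʳ pre (here refl)) (begin
  stepIn a (runs π)                          ≡⟨ cong (stepIn a) runs≡ ⟩
  stepIn a (ps ++ W ∷ runs (c ∷ rest))       ≡⟨ stepIn-++ ps _ (a∉pre ∘ ∈-++⁺ˡ) ⟩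
  stepIn a (W ∷ runs (c ∷ rest))             ≡⟨ stepIn-here W (runs (c ∷ rest)) a∈W ⟩
  classify a W                               ≡⟨ classify-boarder a∈W (a∉pre ∘ ∈-++⁺ʳ (concat ps) ∘ here) a≢last ⟩
  H̃                                          ∎)
  where
  open ≡-Reasoning
  π = pre ++ a ∷ b ∷ c ∷ rest
  W = y ∷ q ++ a ∷ b ∷ []
  a∈W = ∈-++⁺ʳ (y ∷ q) (here refl)
  a∉pre = ∉-prefix pre u (here refl)
  a≢last : a ≢ lastOf W
  a≢last a≡last = <⇒≢ (<-trans a<c c<b) (trans a≡last (lastOf-++ (y ∷ q) a (b ∷ [])))
... | ps , [] , refl , runs≡ with runs-first c rest
...   | r , rs , runs-c , _ = classify-first c r (begin
  classify c (c ∷ r)                          ≡⟨ stepIn-here (c ∷ r) rs (here refl) ⟨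
  stepIn c ((c ∷ r) ∷ rs)                     ≡⟨ stepIn-there (a ∷ b ∷ []) ((c ∷ r) ∷ rs) c∉ab ⟨
  stepIn c ((a ∷ b ∷ []) ∷ (c ∷ r) ∷ rs)      ≡⟨ stepIn-++ ps _ (c∉pre ∘ ∈-++⁺ˡ) ⟨
  stepIn c (ps ++ (a ∷ b ∷ []) ∷ (c ∷ r) ∷ rs) ≡⟨ cong (stepIn c) runs≡′ ⟨
  stepOf π c                                  ≡⟨ coveredTails c c∈π level-c ⟩
  D                                           ∎)
  where
  open ≡-Reasoning
  π = pre ++ a ∷ b ∷ c ∷ rest
  runs≡′ : runs π ≡ ps ++ (a ∷ b ∷ []) ∷ (c ∷ r) ∷ rs
  runs≡′ = trans runs≡ (cong (λ rs′ → ps ++ (a ∷ b ∷ []) ∷ rs′) runs-c)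
  c∈π = ∈-++⁺ʳ pre (there (there (here refl)))
  c∉pre = ∉-prefix pre u (there (there (here refl)))
  c∉ab = All¬⇒¬Any (((<⇒≢ a<c) ∘ sym) ∷ (<⇒≢ c<b) ∷ [])
  regroup : (pre ++ [ a ]) ++ b ∷ c ∷ rest ≡ π
  regroup = ++-assoc pre [ a ] (b ∷ c ∷ rest)
  u′ = subst Unique (sym regroup) u
  b-before-c : posOf b π < posOf c π
  b-before-c = subst (λ L → posOf b L < posOf c L) regroup
    (posOf-adjacent (pre ++ [ a ]) rest (∉-prefix (pre ++ [ a ]) u′ (here refl))
      (∉-prefix (pre ++ [ a ]) u′ (there (here refl))) (<⇒≢ c<b))
  level-c : 0 < levelOf π c
  level-c = subst (λ rs → 0 < countᵇ (covers π c) rs) (sym runs≡′)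
    (countᵇ-positive (covers π c) ps _ (covers-complete π c (a ∷ b ∷ []) (a<c , c<b , b-before-c)))

conditions⇒avoids : ∀ π pre L → π ≡ pre ++ L → Unique π → NoBoarders π → CoveredAreTails π →
  Avoids132-123 L
conditions⇒avoids π pre []              _    _ _  _  = _
conditions⇒avoids π pre (_ ∷ [])        _    _ _  _  = _
conditions⇒avoids π pre (_ ∷ _ ∷ [])    _    _ _  _  = _
conditions⇒avoids π pre (a ∷ b ∷ c ∷ rest) refl u nb ct =
  (λ (a<c , c<b) → 132-violation pre rest u nb ct a<c c<b) ,
  (λ (a<b , b<c) → nb b (∈-++⁺ʳ pre (there (here refl))) (123-boarder pre rest u a<b b<c)) ,
  conditions⇒avoids π (pre ++ [ a ]) (b ∷ c ∷ rest) (sym (++-assoc pre [ a ] _)) u nb ct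

avoids⇔conditions : ∀ π → Unique π → Avoids132-123 π ⇔ (NoBoarders π × CoveredAreTails π)
avoids⇔conditions π u =
  mk⇔ (avoids⇒conditions π u) (λ (nb , ct) → conditions⇒avoids π [] π refl u nb ct)

Γ-conditions⇔ : ∀ n π →
  (((k : Fin n) → lookup (proj₁ (Γ n π)) k ≢ H̃) ×
   ((k : Fin n) → 0 < lookup (proj₂ (Γ n π)) k → lookup (proj₁ (Γ n π)) k ≡ D)) ⇔
  (((k : Fin n) → stepOf π (suc (toℕ k)) ≢ H̃) ×
   ((k : Fin n) → 0 < levelOf π (suc (toℕ k)) → stepOf π (suc (toℕ k)) ≡ D))
Γ-conditions⇔ n π = mk⇔
  (λ (i , ii) → (λ k → subst (_≢ H̃) (step k) (i k)) ,
                (λ k l → trans (sym (step k)) (ii k (subst (0 <_) (sym (level k)) l))))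
  (λ (i , ii) → (λ k → subst (_≢ H̃) (sym (step k)) (i k)) ,
                (λ k l → trans (step k) (ii k (subst (0 <_) (level k) l))))
  where
  step : (k : Fin n) → lookup (proj₁ (Γ n π)) k ≡ stepOf π (suc (toℕ k))
  step = lookup∘tabulate (λ k → stepOf π (suc (toℕ k)))
  level : (k : Fin n) → lookup (proj₂ (Γ n π)) k ≡ levelOf π (suc (toℕ k))
  level = lookup∘tabulate (λ k → levelOf π (suc (toℕ k)))

proposition2p3 : (n : ℕ) (π : List ℕ) → IsPerm n π →
    Avoids132-123 π ⇔
      (((k : Fin n) → lookup (proj₁ (Γ n π)) k ≢ H̃) ×
       ((k : Fin n) → 0 < lookup (proj₂ (Γ n π)) k → lookup (proj₁ (Γ n π)) k ≡ D))
proposition2p3 n π perm =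
  ⇔-trans (avoids⇔conditions π (perm-unique perm))
    (⇔-sym (⇔-trans (Γ-conditions⇔ n π)
      (values⇔entries perm (λ v → stepOf π v ≢ H̃) ×-⇔
       values⇔entries perm (λ v → 0 < levelOf π v → stepOf π v ≡ D))))
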